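{- Let $E=\{m\in\mathbb{N} : ex(m)\equiv 0 \pmod 2\}$ and $\overline E=\mathbb{N}\setminus E$. If $n$ is a power of $4$, then (a) $(\sqrt n)!^{\sqrt n}\le T(n,E)\le \dfrac{n!}{(\sqrt n)!^{\sqrt n}}$, and (b) $(\sqrt n)!^{\sqrt n}\le T(n,\overline E)\le \dfrac{n!}{(\sqrt n)!^{\sqrt n}}$.
   Context: Here $\mathbb{N}=\{1,2,3,\dots\}$ and $[n]=\{1,\dots,n\}$. For $m\in\mathbb{N}$, $ex(m)$ denotes the largest $s$ such that $2^s$ divides $m$. For $D\subseteq\mathbb{N}$, two permutations $\pi,\sigma$ of $[n]$ are called $G(D)$-different if there is a position $i\in[n]$ with $|\pi(i)-\sigma(i)|\in D$. $T(n,D)$ denotes the maximum cardinality of a set of permutations of $[n]$ any two distinct members of which are $G(D)$-different. -}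

module Defs where

open import Data.Nat using (ℕ; suc; _≤_; _^_; _%_; ∣_-_∣)
open import Data.Nat.Divisibility using (_∣_)
open import Data.Fin using (Fin; toℕ)
open import Data.Fin.Permutation using (Permutation′; _⟨$⟩ʳ_)
open import Data.List using (List; length)
open import Data.List.Relation.Unary.AllPairs using (AllPairs)
open import Data.Product using (Σ; ∃; _×_)
open import Relation.Binary.PropositionalEquality using (_≡_)
open import Relation.Nullary using (¬_)

ExIs : ℕ → ℕ → Set
ExIs m s = (2 ^ s ∣ m) × ¬ (2 ^ suc s ∣ m)

E : ℕ → Set
E m = (1 ≤ m) × (∃ λ s → ExIs m s × (s % 2 ≡ 0))

Ebar : ℕ → Set
Ebar m = (1 ≤ m) × ¬ E m

-- Permutations of [n] (represented as Fin n, values shifted by one,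
-- which does not affect differences).
-- π and σ are G(D)-different: some position i with |π(i) - σ(i)| ∈ D
GDifferent : (ℕ → Set) → {n : ℕ} → Permutation′ n → Permutation′ n → Set
GDifferent D {n} π σ =
  ∃ λ (i : Fin n) → D ∣ toℕ (π ⟨$⟩ʳ i) - toℕ (σ ⟨$⟩ʳ i) ∣

GDFamily : (ℕ → Set) → (n : ℕ) → List (Permutation′ n) → Set
GDFamily D n ps = AllPairs (GDifferent D) ps

-- k ≤ T(n,D): there is such a family of cardinality at least k
T≥ : ℕ → (ℕ → Set) → ℕ → Set
T≥ n D k = Σ (List (Permutation′ n)) λ ps → GDFamily D n ps × (k ≤ length ps)

-- T(n,D) * d ≤ u : every such family ps satisfies |ps| * d ≤ u
T*≤ : ℕ → (ℕ → Set) → ℕ → ℕ → Set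
T*≤ n D d u = (ps : List (Permutation′ n)) → GDFamily D n ps → Data.Nat._*_ (length ps) d ≤ u

module Submission where

-- Idea.  Split each base-4 digit of x < 4^j into a high and a low bit; collecting
-- these bits gives a bijection ψ : Fin (4^j) ≅ Fin (2^j) × Fin (2^j), x ↦ (h, l).
-- If two points share h but not l, the lowest base-4 digit where they differ
-- differs in its low bit, so their distance is 4^k·odd ∈ E; if they share l but
-- not h, their distance is 4^k·2·odd ∈ Ebar.  Now cut Fin (4^j) into 2^j blocks
-- of 2^j points along one coordinate of ψ.  The (2^j)!^(2^j) permutations acting
-- separately inside the blocks are pairwise G(D)-different when within-block
-- distances lie in D (lower bound).  If instead within-block distances avoid D,
-- then for any G(D)-family ps the products a ∘ (block permutation) are pairwise
-- distinct, so |ps|·(2^j)!^(2^j) ≤ (4^j)! (upper bound).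

open import Defs
open import Data.Nat using (ℕ; zero; suc; _+_; _*_; _∸_; _^_; _%_; _!; _≤_; z≤n; s≤s; ∣_-_∣)
import Data.Nat.Properties as ℕ
open import Data.Nat.Divisibility using (_∣_; divides; 1∣_; m∣m*n; ∣m⇒∣m*n; m*n∣⇒m∣; *-monoʳ-∣; *-cancelˡ-∣)
open import Data.Nat.DivMod using ([m+n]%n≡m%n)
open import Data.Nat.Tactic.RingSolver using (solve-∀)
open import Data.Fin using (Fin; zero; suc; toℕ; cast; combine; punchIn; _<_; _≟_)
import Data.Fin.Properties as FinP
open import Data.Fin.Permutation
  using (Permutation′; _⟨$⟩ʳ_; _⟨$⟩ˡ_; inverseˡ; inverseʳ; _∘ₚ_; id; insert; remove; insert-punchIn; insert-remove)
  renaming (_≈_ to _≈ₚ_)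
open import Data.List using (List; []; _∷_; [_]; map; _++_; length; lookup; allFin; cartesianProductWith)
open import Data.List.Properties using (length-map; length-++; length-tabulate)
open import Data.List.Relation.Unary.All using (All)
import Data.List.Relation.Unary.All as All
import Data.List.Relation.Unary.All.Properties as All
open import Data.List.Relation.Unary.AllPairs using (AllPairs; []; _∷_)
import Data.List.Relation.Unary.AllPairs as AllPairs
import Data.List.Relation.Unary.AllPairs.Properties as AllPairs
open import Data.List.Relation.Unary.Any using (Any; here)
import Data.List.Relation.Unary.Any as Any
import Data.List.Relation.Unary.Any.Properties as Any
open import Data.List.Membership.Propositional.Properties using (∈-lookup; ∈-allFin)
import Data.Vec.Functional as Vector
open import Data.Product using (∃; ∃₂; _×_; _,_; proj₁; proj₂)
open import Data.Product.Algebra using (×-comm)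
open import Data.Product.Function.NonDependent.Propositional using (_×-↔_)
open import Data.Sum using (_⊎_; inj₁; inj₂; reduce)
open import Data.Empty using (⊥; ⊥-elim)
open import Function using (_∘_)
open import Function.Bundles using (_↔_; Inverse; Injection; mk↔ₛ′)
open import Function.Properties.Inverse using (↔-trans; ↔-sym; ↔⇒↣)
open import Relation.Nullary using (¬_; yes; no; contradiction)
open import Relation.Binary.PropositionalEquality hiding ([_])

2^[2+n]≡4*2^n : ∀ n → 2 ^ (2 + n) ≡ 4 * 2 ^ n
2^[2+n]≡4*2^n n = sym (ℕ.*-assoc 2 2 (2 ^ n))

ExIs-×4 : ∀ {d s} → ExIs d s → ExIs (4 * d) (2 + s)
ExIs-×4 {d} {s} (2ˢ∣d , 2ˢ⁺¹∤d) =
  subst (_∣ 4 * d) (sym (2^[2+n]≡4*2^n s)) (*-monoʳ-∣ 4 2ˢ∣d) ,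
  2ˢ⁺¹∤d ∘ *-cancelˡ-∣ 4 ∘ subst (_∣ 4 * d) (2^[2+n]≡4*2^n (suc s))

ExIs-÷4 : ∀ {d s} → ExIs (4 * d) (2 + s) → ExIs d s
ExIs-÷4 {d} {s} (2ˢ⁺²∣4d , 2ˢ⁺³∤4d) =
  *-cancelˡ-∣ 4 (subst (_∣ 4 * d) (2^[2+n]≡4*2^n s) 2ˢ⁺²∣4d) ,
  2ˢ⁺³∤4d ∘ subst (_∣ 4 * d) (sym (2^[2+n]≡4*2^n (suc s))) ∘ *-monoʳ-∣ 4

2∤odd : ∀ m → ¬ (2 ∣ suc (2 * m))
2∤odd m (divides q eq) = ℕ.even≢odd q m (sym (trans eq (ℕ.*-comm q 2)))

odd∈E : ∀ m → E (suc (2 * m))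
odd∈E m = s≤s z≤n , 0 , (1∣ _ , 2∤odd m) , refl

twiceOdd∈Ebar : ∀ m → Ebar (2 * suc (2 * m))
twiceOdd∈Ebar m = s≤s z≤n , notE
  where
  notE : ¬ E (2 * suc (2 * m))
  notE (_ , zero , (_ , 2∤) , _) = 2∤ (m∣m*n (suc (2 * m)))
  notE (_ , suc zero , _ , ())
  notE (_ , suc (suc s) , (2ˢ⁺²∣ , _) , _) =
    2∤odd m (m*n∣⇒m∣ 2 (2 ^ s) (*-cancelˡ-∣ 2 2ˢ⁺²∣))

[2+n]%2≡n%2 : ∀ n → (2 + n) % 2 ≡ n % 2
[2+n]%2≡n%2 n = trans (cong (_% 2) (ℕ.+-comm 2 n)) ([m+n]%n≡m%n n 2)

positive-×4 : ∀ {d} → 1 ≤ d → 1 ≤ 4 * d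
positive-×4 {suc d} _ = s≤s z≤n

E-×4 : ∀ {d} → E d → E (4 * d)
E-×4 {d} (1≤d , s , exIs , s-even) =
  positive-×4 1≤d , 2 + s , ExIs-×4 {s = s} exIs , trans ([2+n]%2≡n%2 s) s-even

E-÷4 : ∀ {d} → E (4 * d) → E d
E-÷4 {zero} (() , _)
E-÷4 {suc d} (_ , zero , (_ , 2∤4d) , _) =
  contradiction (∣m⇒∣m*n (suc d) (divides 2 refl)) 2∤4d
E-÷4 {suc d} (_ , suc zero , _ , ())
E-÷4 {suc d} (_ , suc (suc s) , exIs , s-even) =
  s≤s z≤n , s , ExIs-÷4 {s = s} exIs , trans (sym ([2+n]%2≡n%2 s)) s-even

Ebar-×4 : ∀ {d} → Ebar d → Ebar (4 * d)
Ebar-×4 (1≤d , d∉E) = positive-×4 1≤d , d∉E ∘ E-÷4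

∣x+c-y+c∣≡∣x-y∣ : ∀ x y c → ∣ x + c - (y + c) ∣ ≡ ∣ x - y ∣
∣x+c-y+c∣≡∣x-y∣ x y c =
  trans (cong₂ ∣_-_∣ (ℕ.+-comm x c) (ℕ.+-comm y c)) (ℕ.∣m+n-m+o∣≡∣n-o∣ c x y)

-- Two numbers with the same last base-4 digit are 4 times as far apart as their
-- truncations; so any distance predicate closed under ×4 propagates upward.
sameDigit : ∀ {P : ℕ → Set} → (∀ {d} → P d → P (4 * d)) →
            ∀ a b r → P ∣ a - b ∣ → P ∣ 4 * a + r - (4 * b + r) ∣
sameDigit {P} P-×4 a b r p =
  subst P (sym (trans (∣x+c-y+c∣≡∣x-y∣ (4 * a) (4 * b) r) (sym (ℕ.*-distribˡ-∣-∣ 4 a b)))) (P-×4 p)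

base4Gap : ∀ a b r → r ≤ 4 →
           ∃ λ t → ∣ 4 * a + r - 4 * b ∣ ≡ 4 * t + r ⊎ ∣ 4 * a + r - 4 * b ∣ ≡ 4 * t + (4 ∸ r)
base4Gap a b r r≤4 with ℕ.≤-<-connex b a
... | inj₁ b≤a with t , refl ← ℕ.m≤n⇒∃[o]m+o≡n b≤a = t , inj₁ (begin
  ∣ 4 * (b + t) + r - 4 * b ∣     ≡⟨ cong (∣_- 4 * b ∣) (expand b t r) ⟩
  ∣ 4 * b + (4 * t + r) - 4 * b ∣ ≡⟨ ℕ.∣-∣-comm (4 * b + (4 * t + r)) (4 * b) ⟩
  ∣ 4 * b - 4 * b + (4 * t + r) ∣ ≡⟨ ℕ.∣m-m+n∣≡n (4 * b) (4 * t + r) ⟩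
  4 * t + r                       ∎)
  where
  open ≡-Reasoning
  expand : ∀ b t r → 4 * (b + t) + r ≡ 4 * b + (4 * t + r)
  expand = solve-∀
... | inj₂ a<b with t , refl ← ℕ.m≤n⇒∃[o]m+o≡n a<b = t , inj₂ (begin
  ∣ 4 * a + r - 4 * (suc a + t) ∣               ≡⟨ cong (∣ 4 * a + r -_∣) split ⟩
  ∣ 4 * a + r - 4 * a + r + (4 * t + (4 ∸ r)) ∣ ≡⟨ ℕ.∣m-m+n∣≡n (4 * a + r) (4 * t + (4 ∸ r)) ⟩
  4 * t + (4 ∸ r)                               ∎)
  where
  open ≡-Reasoning
  expand : ∀ a t → 4 * (suc a + t) ≡ 4 * a + 4 * t + 4
  expand = solve-∀
  regroup : ∀ x y r s → x + y + (r + s) ≡ x + r + (y + s)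
  regroup = solve-∀
  split : 4 * (suc a + t) ≡ 4 * a + r + (4 * t + (4 ∸ r))
  split = begin
    4 * (suc a + t)               ≡⟨ expand a t ⟩
    4 * a + 4 * t + 4             ≡⟨ cong (4 * a + 4 * t +_) (sym (ℕ.m+[n∸m]≡n r≤4)) ⟩
    4 * a + 4 * t + (r + (4 ∸ r)) ≡⟨ regroup (4 * a) (4 * t) r (4 ∸ r) ⟩
    4 * a + r + (4 * t + (4 ∸ r)) ∎

-- Last digits c + 1 and c + 0: the distance is odd, hence in E.
oddGap∈E : ∀ a b c → E ∣ 4 * a + (c + 1) - (4 * b + (c + 0)) ∣
oddGap∈E a b c = subst E (sym shift) (odd (base4Gap a b 1 (s≤s z≤n)))
  where
  shift : ∣ 4 * a + (c + 1) - (4 * b + (c + 0)) ∣ ≡ ∣ 4 * a + 1 - 4 * b ∣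
  shift = trans (cong₂ ∣_-_∣ (regroup (4 * a) c) (regroup′ (4 * b) c))
                (∣x+c-y+c∣≡∣x-y∣ (4 * a + 1) (4 * b) c)
    where
    regroup : ∀ x c → x + (c + 1) ≡ x + 1 + c
    regroup = solve-∀
    regroup′ : ∀ y c → y + (c + 0) ≡ y + c
    regroup′ = solve-∀
  odd : ∀ {d} → (∃ λ t → d ≡ 4 * t + 1 ⊎ d ≡ 4 * t + (4 ∸ 1)) → E d
  odd (t , inj₁ gap) = subst E (sym (trans gap (4t+1 t))) (odd∈E (2 * t))
    where
    4t+1 : ∀ t → 4 * t + 1 ≡ suc (2 * (2 * t))
    4t+1 = solve-∀
  odd (t , inj₂ gap) = subst E (sym (trans gap (4t+3 t))) (odd∈E (suc (2 * t)))
    where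
    4t+3 : ∀ t → 4 * t + 3 ≡ suc (2 * suc (2 * t))
    4t+3 = solve-∀

-- Last digits 2 + c and c: the distance is twice an odd number, hence in Ebar.
twiceOddGap∈Ebar : ∀ a b c → Ebar ∣ 4 * a + (2 + c) - (4 * b + c) ∣
twiceOddGap∈Ebar a b c = subst Ebar (sym shift) (twiceOdd (base4Gap a b 2 (s≤s (s≤s z≤n))))
  where
  shift : ∣ 4 * a + (2 + c) - (4 * b + c) ∣ ≡ ∣ 4 * a + 2 - 4 * b ∣
  shift = trans (cong (∣_- 4 * b + c ∣) (sym (ℕ.+-assoc (4 * a) 2 c)))
                (∣x+c-y+c∣≡∣x-y∣ (4 * a + 2) (4 * b) c)
  twiceOdd : ∀ {d} → (∃ λ t → d ≡ 4 * t + 2 ⊎ d ≡ 4 * t + (4 ∸ 2)) → Ebar d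
  twiceOdd (t , gap) = subst Ebar (sym (trans (reduce gap) (4t+2 t))) (twiceOdd∈Ebar t)
    where
    4t+2 : ∀ t → 4 * t + 2 ≡ 2 * suc (2 * t)
    4t+2 = solve-∀

cast↔ : ∀ {m n} → m ≡ n → Fin m ↔ Fin n
cast↔ eq = mk↔ₛ′ (cast eq) (cast (sym eq)) (FinP.cast-involutive eq (sym eq)) (FinP.cast-involutive (sym eq) eq)

-- Splitting off the least significant base-b digit: x ↦ (x div b , x mod b).
lowDigit : ∀ b j → Fin (b ^ suc j) ↔ (Fin (b ^ j) × Fin b)
lowDigit b j = ↔-trans (cast↔ (ℕ.*-comm b (b ^ j))) FinP.*↔×

toℕ-lowDigit⁻¹ : ∀ b j q r → toℕ (Inverse.from (lowDigit b j) (q , r)) ≡ b * toℕ q + toℕ r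
toℕ-lowDigit⁻¹ b j q r = trans (FinP.toℕ-cast _ (combine q r)) (FinP.toℕ-combine q r)

-- Write the base-4 digits of x as 2·hᵢ + lᵢ with bits hᵢ, lᵢ; then ψ j x = (h, l)
-- where h and l are the numbers with binary digits hᵢ and lᵢ respectively.
ψ : ∀ j → Fin (4 ^ j) ↔ (Fin (2 ^ j) × Fin (2 ^ j))
ψ zero    = FinP.*↔×
ψ (suc j) = ↔-trans (lowDigit 4 j)
            (↔-trans (ψ j ×-↔ FinP.*↔×)
            (↔-trans interchange
                     (↔-sym (lowDigit 2 j) ×-↔ ↔-sym (lowDigit 2 j))))
  where
  interchange : ∀ {A B C D : Set} → ((A × B) × (C × D)) ↔ ((A × C) × (B × D))
  interchange = mk↔ₛ′ swapInner swapInner (λ _ → refl) (λ _ → refl)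
    where
    swapInner : ∀ {A B C D : Set} → (A × B) × (C × D) → (A × C) × (B × D)
    swapInner ((a , b) , (c , d)) = (a , c) , (b , d)

ψ→ : ∀ j → Fin (4 ^ j) → Fin (2 ^ j) × Fin (2 ^ j)
ψ→ j = Inverse.to (ψ j)

ψ⁻¹ : ∀ j → Fin (2 ^ j) × Fin (2 ^ j) → Fin (4 ^ j)
ψ⁻¹ j = Inverse.from (ψ j)

bits : ∀ j → Fin (2 ^ suc j) → Fin (2 ^ j) × Fin 2
bits j = Inverse.to (lowDigit 2 j)

toℕ-ψ⁻¹ : ∀ j h l → toℕ (ψ⁻¹ (suc j) (h , l)) ≡
  4 * toℕ (ψ⁻¹ j (proj₁ (bits j h) , proj₁ (bits j l))) + (2 * toℕ (proj₂ (bits j h)) + toℕ (proj₂ (bits j l)))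
toℕ-ψ⁻¹ j h l = trans (toℕ-lowDigit⁻¹ 4 j prefix lastDigit)
                       (cong (4 * toℕ prefix +_) (FinP.toℕ-combine (proj₂ (bits j h)) (proj₂ (bits j l))))
  where
  prefix : Fin (4 ^ j)
  prefix = ψ⁻¹ j (proj₁ (bits j h) , proj₁ (bits j l))
  lastDigit : Fin 4
  lastDigit = combine (proj₂ (bits j h)) (proj₂ (bits j l))

bits-injective : ∀ j {x y} → bits j x ≡ bits j y → x ≡ y
bits-injective j = Injection.injective (↔⇒↣ (lowDigit 2 j))

-- Two points with the same high coordinate and different low coordinates are at
-- a distance in E: at the lowest base-4 digit where they differ, only the low bit
-- changes, so the distance is 4^k times an odd number.
sameHigh⇒E : ∀ j h l l′ → l ≢ l′ → E ∣ toℕ (ψ⁻¹ j (h , l)) - toℕ (ψ⁻¹ j (h , l′)) ∣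
sameHigh⇒E zero    h zero zero l≢l′ = contradiction refl l≢l′
sameHigh⇒E (suc j) h l l′ l≢l′ =
  subst E (sym (cong₂ ∣_-_∣ (toℕ-ψ⁻¹ j h l) (toℕ-ψ⁻¹ j h l′)))
        (lastDigit (bits j l) (bits j l′) (l≢l′ ∘ bits-injective j))
  where
  -- Dropping the last base-4 digit of ψ⁻¹ (h , l) leaves ψ⁻¹ (h₁ , l₁), whose
  -- value is A l₁; c is twice the common last high bit.
  h₁ : Fin (2 ^ j)
  h₁ = proj₁ (bits j h)
  A : Fin (2 ^ j) → ℕ
  A l₁ = toℕ (ψ⁻¹ j (h₁ , l₁))
  c : ℕ
  c = 2 * toℕ (proj₂ (bits j h))
  sameLast : ∀ {l₁ l₁′ r} → l₁ ≢ l₁′ → E ∣ 4 * A l₁ + r - (4 * A l₁′ + r) ∣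
  sameLast {l₁} {l₁′} {r} l₁≢l₁′ =
    sameDigit {E} E-×4 (A l₁) (A l₁′) r (sameHigh⇒E j h₁ l₁ l₁′ l₁≢l₁′)
  lastDigit : ∀ L L′ → L ≢ L′ →
    E ∣ 4 * A (proj₁ L) + (c + toℕ (proj₂ L)) - (4 * A (proj₁ L′) + (c + toℕ (proj₂ L′))) ∣
  lastDigit (l₁ , suc zero) (l₁′ , zero)     _  = oddGap∈E (A l₁) (A l₁′) c
  lastDigit (l₁ , zero)     (l₁′ , suc zero) _  =
    subst E (ℕ.∣-∣-comm (4 * A l₁′ + (c + 1)) (4 * A l₁ + (c + 0))) (oddGap∈E (A l₁′) (A l₁) c)
  lastDigit (l₁ , zero)     (l₁′ , zero)     ne = sameLast (ne ∘ cong (_, zero))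
  lastDigit (l₁ , suc zero) (l₁′ , suc zero) ne = sameLast (ne ∘ cong (_, suc zero))

-- Dually, the same low coordinate and different high coordinates give a distance
-- 4^k times twice an odd number, which lies in Ebar.
sameLow⇒Ebar : ∀ j h h′ l → h ≢ h′ → Ebar ∣ toℕ (ψ⁻¹ j (h , l)) - toℕ (ψ⁻¹ j (h′ , l)) ∣
sameLow⇒Ebar zero    zero zero l h≢h′ = contradiction refl h≢h′
sameLow⇒Ebar (suc j) h h′ l h≢h′ =
  subst Ebar (sym (cong₂ ∣_-_∣ (toℕ-ψ⁻¹ j h l) (toℕ-ψ⁻¹ j h′ l)))
        (lastDigit (bits j h) (bits j h′) (h≢h′ ∘ bits-injective j))
  where
  l₁ : Fin (2 ^ j)
  l₁ = proj₁ (bits j l)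
  A : Fin (2 ^ j) → ℕ
  A h₁ = toℕ (ψ⁻¹ j (h₁ , l₁))
  c : ℕ
  c = toℕ (proj₂ (bits j l))
  sameLast : ∀ {h₁ h₁′ r} → h₁ ≢ h₁′ → Ebar ∣ 4 * A h₁ + r - (4 * A h₁′ + r) ∣
  sameLast {h₁} {h₁′} {r} h₁≢h₁′ =
    sameDigit {Ebar} Ebar-×4 (A h₁) (A h₁′) r (sameLow⇒Ebar j h₁ h₁′ l₁ h₁≢h₁′)
  lastDigit : ∀ H H′ → H ≢ H′ →
    Ebar ∣ 4 * A (proj₁ H) + (2 * toℕ (proj₂ H) + c) - (4 * A (proj₁ H′) + (2 * toℕ (proj₂ H′) + c)) ∣
  lastDigit (h₁ , suc zero) (h₁′ , zero)     _  = twiceOddGap∈Ebar (A h₁) (A h₁′) c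
  lastDigit (h₁ , zero)     (h₁′ , suc zero) _  =
    subst Ebar (ℕ.∣-∣-comm (4 * A h₁′ + (2 + c)) (4 * A h₁ + c)) (twiceOddGap∈Ebar (A h₁′) (A h₁) c)
  lastDigit (h₁ , zero)     (h₁′ , zero)     ne = sameLast (ne ∘ cong (_, zero))
  lastDigit (h₁ , suc zero) (h₁′ , suc zero) ne = sameLast (ne ∘ cong (_, suc zero))

viaCoordinates : ∀ j (P : ℕ → Set) (R : (p q : Fin (2 ^ j) × Fin (2 ^ j)) → Set) →
  (∀ p q → R p q → p ≢ q → P ∣ toℕ (ψ⁻¹ j p) - toℕ (ψ⁻¹ j q) ∣) →
  ∀ u v → R (ψ→ j u) (ψ→ j v) → u ≢ v → P ∣ toℕ u - toℕ v ∣
viaCoordinates j P R onCoords u v r u≢v =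
  subst P (cong₂ (λ x y → ∣ toℕ x - toℕ y ∣) (ψ⁻¹ψ u) (ψ⁻¹ψ v))
        (onCoords (ψ→ j u) (ψ→ j v) r (u≢v ∘ Injection.injective (↔⇒↣ (ψ j))))
  where
  ψ⁻¹ψ : ∀ x → ψ⁻¹ j (ψ→ j x) ≡ x
  ψ⁻¹ψ = Inverse.strictlyInverseʳ (ψ j)

sameHighPoints⇒E : ∀ j u v → proj₁ (ψ→ j u) ≡ proj₁ (ψ→ j v) → u ≢ v → E ∣ toℕ u - toℕ v ∣
sameHighPoints⇒E j = viaCoordinates j E (λ p q → proj₁ p ≡ proj₁ q) onCoords
  where
  onCoords : ∀ p q → proj₁ p ≡ proj₁ q → p ≢ q → E ∣ toℕ (ψ⁻¹ j p) - toℕ (ψ⁻¹ j q) ∣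
  onCoords (h , l) (.h , l′) refl p≢q = sameHigh⇒E j h l l′ (p≢q ∘ cong (h ,_))

sameLowPoints⇒Ebar : ∀ j u v → proj₂ (ψ→ j u) ≡ proj₂ (ψ→ j v) → u ≢ v → Ebar ∣ toℕ u - toℕ v ∣
sameLowPoints⇒Ebar j = viaCoordinates j Ebar (λ p q → proj₂ p ≡ proj₂ q) onCoords
  where
  onCoords : ∀ p q → proj₂ p ≡ proj₂ q → p ≢ q → Ebar ∣ toℕ (ψ⁻¹ j p) - toℕ (ψ⁻¹ j q) ∣
  onCoords (h , l) (h′ , .l) refl p≢q = sameLow⇒Ebar j h h′ l (p≢q ∘ cong (_, l))

-- π and σ are apart if they differ at some point (constructive form of π ≠ σ).
Apart : ∀ {n} → Permutation′ n → Permutation′ n → Set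
Apart π σ = ∃ λ x → π ⟨$⟩ʳ x ≢ σ ⟨$⟩ʳ x

module _ {A B C : Set} (f : A → B → C) where

  length-cartesianProductWith : ∀ xs ys →
    length (cartesianProductWith f xs ys) ≡ length xs * length ys
  length-cartesianProductWith []       ys = refl
  length-cartesianProductWith (x ∷ xs) ys = begin
    length (map (f x) ys ++ cartesianProductWith f xs ys)       ≡⟨ length-++ (map (f x) ys) ⟩
    length (map (f x) ys) + length (cartesianProductWith f xs ys) ≡⟨ cong₂ _+_ (length-map (f x) ys) (length-cartesianProductWith xs ys) ⟩
    length ys + length xs * length ys                            ∎
    where open ≡-Reasoning

  AllPairs-cartesianProductWith : ∀ {R : A → A → Set} {S : B → B → Set} {T : C → C → Set} →
    (∀ x x′ y y′ → R x x′ → T (f x y) (f x′ y′)) →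
    (∀ x y y′ → S y y′ → T (f x y) (f x y′)) →
    ∀ {xs ys} → AllPairs R xs → AllPairs S ys → AllPairs T (cartesianProductWith f xs ys)
  AllPairs-cartesianProductWith sep₁ sep₂ {[]} [] _ = []
  AllPairs-cartesianProductWith {T = T} sep₁ sep₂ {x ∷ xs} {ys} (rx ∷ rxs) rys =
    AllPairs.++⁺ (AllPairs.map⁺ (AllPairs.map (sep₂ x _ _) rys))
                 (AllPairs-cartesianProductWith sep₁ sep₂ rxs rys)
                 (All.map⁺ (All.universal across ys))
    where
    across : ∀ y → All (T (f x y)) (cartesianProductWith f xs ys)
    across y = All.cartesianProductWith⁺ (setoid A) (setoid B) f xs ys
                 (λ x′∈xs _ → sep₁ x _ y _ (All.lookup rx x′∈xs))

-- The list of all permutations of Fin k.  A permutation of Fin (1+k) is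
-- determined by the image j of 0 and the permutation it induces on the other
-- points, and insert 0 j reassembles it.
permutations : ∀ k → List (Permutation′ k)
permutations zero    = [ id ]
permutations (suc k) = cartesianProductWith (insert zero) (allFin (suc k)) (permutations k)

length-permutations : ∀ k → length (permutations k) ≡ k !
length-permutations zero    = refl
length-permutations (suc k) =
  trans (length-cartesianProductWith (insert zero) (allFin (suc k)) (permutations k))
        (cong₂ _*_ (length-tabulate {n = suc k} (λ x → x)) (length-permutations k))

insert-cong : ∀ {k} (j : Fin (suc k)) {π σ : Permutation′ k} → π ≈ₚ σ → insert zero j π ≈ₚ insert zero j σ
insert-cong j π≈σ zero    = refl
insert-cong j {π} {σ} π≈σ (suc x) = begin
  insert zero j π ⟨$⟩ʳ suc x ≡⟨ insert-punchIn zero j π x ⟩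
  punchIn j (π ⟨$⟩ʳ x)       ≡⟨ cong (punchIn j) (π≈σ x) ⟩
  punchIn j (σ ⟨$⟩ʳ x)       ≡⟨ insert-punchIn zero j σ x ⟨
  insert zero j σ ⟨$⟩ʳ suc x ∎
  where open ≡-Reasoning

-- Any two listed permutations are apart: they differ at 0, or else inside.
permutations-apart : ∀ k → AllPairs Apart (permutations k)
permutations-apart zero    = All.[] ∷ []
permutations-apart (suc k) =
  AllPairs-cartesianProductWith (insert zero) differentImage sameImage
    (AllPairs.tabulate⁺ (λ i≢j → i≢j)) (permutations-apart k)
  where
  differentImage : ∀ i j π σ → i ≢ j → Apart (insert zero i π) (insert zero j σ)
  differentImage _ _ _ _ i≢j = zero , i≢j
  sameImage : ∀ j π σ → Apart π σ → Apart (insert zero j π) (insert zero j σ)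
  sameImage j π σ (x , πx≢σx) = suc x , λ eq → πx≢σx (FinP.punchIn-injective j _ _
    (trans (sym (insert-punchIn zero j π x)) (trans eq (insert-punchIn zero j σ x))))

permutations-complete : ∀ k (π : Permutation′ k) → Any (_≈ₚ π) (permutations k)
permutations-complete zero    π = here (λ ())
permutations-complete (suc k) π =
  Any.cartesianProductWith⁺ (insert zero) rebuild (∈-allFin (π ⟨$⟩ʳ zero))
    (permutations-complete k (remove zero π))
  where
  rebuild : ∀ {j σ} → π ⟨$⟩ʳ zero ≡ j → σ ≈ₚ remove zero π → insert zero j σ ≈ₚ π
  rebuild refl σ≈ x = trans (insert-cong _ σ≈ x) (insert-remove zero π x)

functions : ∀ {A : Set} k → List A → List (Fin k → A)
functions zero    xs = [ (λ ()) ]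
functions (suc k) xs = cartesianProductWith Vector._∷_ xs (functions k xs)

length-functions : ∀ {A : Set} k (xs : List A) → length (functions k xs) ≡ length xs ^ k
length-functions zero    xs = refl
length-functions (suc k) xs =
  trans (length-cartesianProductWith Vector._∷_ xs (functions k xs))
        (cong (length xs *_) (length-functions k xs))

functions-apart : ∀ {A : Set} {R : A → A → Set} k {xs} → AllPairs R xs →
                  AllPairs (λ f g → ∃ λ i → R (f i) (g i)) (functions k xs)
functions-apart zero    _   = All.[] ∷ []
functions-apart (suc k) rxs = AllPairs-cartesianProductWith Vector._∷_
  (λ _ _ _ _ r → zero , r) (λ _ _ _ (i , r) → suc i , r) rxs (functions-apart k rxs)

lookup-AllPairs : ∀ {A : Set} {R : A → A → Set} {xs} → AllPairs R xs →
                  ∀ {i j} → i < j → R (lookup xs i) (lookup xs j)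
lookup-AllPairs (rx ∷ _)   {zero}  {suc j} _         = All.lookup rx (∈-lookup j)
lookup-AllPairs (_  ∷ rxs) {suc i} {suc j} (s≤s i<j) = lookup-AllPairs rxs i<j

-- Counting by pigeonhole: a list whose members are pairwise R-related, where R
-- forbids being ≈ to a common element, is no longer than any list ys that
-- covers every element up to ≈.
length-≤-cover : ∀ {A : Set} {_≈_ R : A → A → Set} ys → (∀ x → Any (_≈ x) ys) →
  (∀ x y z → R x y → z ≈ x → z ≈ y → ⊥) →
  ∀ {xs} → AllPairs R xs → length xs ≤ length ys
length-≤-cover {_≈_ = _≈_} ys cover separated {xs} rxs with length xs ℕ.≤? length ys
... | yes xs≤ys = xs≤ys
... | no  xs≰ys = ⊥-elim (collision (FinP.pigeonhole (ℕ.≰⇒> xs≰ys) position))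
  where
  position : Fin (length xs) → Fin (length ys)
  position i = Any.index (cover (lookup xs i))
  ≈-at : ∀ i → lookup ys (position i) ≈ lookup xs i
  ≈-at i = Any.lookup-index (cover (lookup xs i))
  collision : (∃₂ λ i j → i < j × position i ≡ position j) → ⊥
  collision (i , j , i<j , same) = separated _ _ _ (lookup-AllPairs rxs i<j)
    (subst (λ p → lookup ys p ≈ lookup xs i) same (≈-at i)) (≈-at j)

apart-separated : ∀ {n} (π σ ρ : Permutation′ n) → Apart π σ → ρ ≈ₚ π → ρ ≈ₚ σ → ⊥
apart-separated _ _ _ (x , πx≢σx) ρ≈π ρ≈σ = πx≢σx (trans (sym (ρ≈π x)) (ρ≈σ x))

apart-≤-factorial : ∀ n {ps : List (Permutation′ n)} → AllPairs Apart ps → length ps ≤ n !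
apart-≤-factorial n {ps} aps =
  subst (length ps ≤_) (length-permutations n)
        (length-≤-cover (permutations n) (permutations-complete n) apart-separated aps)

-- Block permutations.  A bijection φ : Fin N ≅ Fin K × Fin M cuts Fin N into K
-- blocks of M points; blockwise F acts as the permutation F b inside block b.
module Blocks {N K M : ℕ} (φ : Fin N ↔ (Fin K × Fin M)) where

  open Inverse φ using () renaming (to to coords; from to point; strictlyInverseˡ to coords-point)

  block : Fin N → Fin K
  block x = proj₁ (coords x)

  blockwise : (Fin K → Permutation′ M) → Permutation′ N
  blockwise F = ↔-trans φ (↔-trans insideBlocks (↔-sym φ))
    where
    insideBlocks : (Fin K × Fin M) ↔ (Fin K × Fin M)
    insideBlocks = mk↔ₛ′ (λ (b , m) → b , F b ⟨$⟩ʳ m) (λ (b , m) → b , F b ⟨$⟩ˡ m)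
      (λ (b , m) → cong (b ,_) (inverseʳ (F b))) (λ (b , m) → cong (b ,_) (inverseˡ (F b)))

  coords-blockwise : ∀ F x → coords (blockwise F ⟨$⟩ʳ x) ≡ (block x , F (block x) ⟨$⟩ʳ proj₂ (coords x))
  coords-blockwise F x = coords-point _

  block-blockwise : ∀ F x → block (blockwise F ⟨$⟩ʳ x) ≡ block x
  block-blockwise F x = cong proj₁ (coords-blockwise F x)

  blockwise-apart : ∀ F G → (∃ λ b → Apart (F b) (G b)) → Apart (blockwise F) (blockwise G)
  blockwise-apart F G (b , m , Fbm≢Gbm) = point (b , m) , Fbm≢Gbm ∘ insideEqual
    where
    image : ∀ H → coords (blockwise H ⟨$⟩ʳ point (b , m)) ≡ (b , H b ⟨$⟩ʳ m)
    image H = trans (coords-blockwise H (point (b , m)))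
                    (cong (λ (c , n) → c , H c ⟨$⟩ʳ n) (coords-point (b , m)))
    insideEqual : blockwise F ⟨$⟩ʳ point (b , m) ≡ blockwise G ⟨$⟩ʳ point (b , m) → F b ⟨$⟩ʳ m ≡ G b ⟨$⟩ʳ m
    insideEqual eq = cong proj₂ (trans (sym (image F)) (trans (cong coords eq) (image G)))

  choices : List (Fin K → Permutation′ M)
  choices = functions K (permutations M)

  length-choices : length choices ≡ (M !) ^ K
  length-choices = trans (length-functions K (permutations M)) (cong (_^ K) (length-permutations M))

  choices-apart : AllPairs (λ F G → ∃ λ b → Apart (F b) (G b)) choices
  choices-apart = functions-apart K (permutations-apart M)

  lowerBound : (D : ℕ → Set) → (∀ u v → block u ≡ block v → u ≢ v → D ∣ toℕ u - toℕ v ∣) →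
               T≥ N D ((M !) ^ K)
  lowerBound D inside =
    map blockwise choices ,
    AllPairs.map⁺ (AllPairs.map (λ {F} {G} → differ F G) choices-apart) ,
    ℕ.≤-reflexive (sym (trans (length-map blockwise choices) length-choices))
    where
    differ : ∀ F G → (∃ λ b → Apart (F b) (G b)) → GDifferent D (blockwise F) (blockwise G)
    differ F G apart with x , Fx≢Gx ← blockwise-apart F G apart =
      x , inside _ _ (trans (block-blockwise F x) (sym (block-blockwise G x))) Fx≢Gx

  -- For a G(D)-family ps, the
  -- permutations "first a, then blockwise F" (a ∈ ps, F a choice) are pairwise
  -- apart, so |ps|·(M!)^K ≤ N!.
  upperBound : (D : ℕ → Set) → (∀ {d} → D d → 1 ≤ d) →
               (∀ u v → block u ≡ block v → u ≢ v → ¬ D ∣ toℕ u - toℕ v ∣) →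
               T*≤ N D ((M !) ^ K) (N !)
  upperBound D positive inside ps family =
    subst (_≤ N !) counted (apart-≤-factorial N products-apart)
    where
    then : Permutation′ N → (Fin K → Permutation′ M) → Permutation′ N
    then a F = a ∘ₚ blockwise F
    products : List (Permutation′ N)
    products = cartesianProductWith then ps choices
    counted : length products ≡ length ps * (M !) ^ K
    counted = trans (length-cartesianProductWith then ps choices) (cong (length ps *_) length-choices)
    -- By positivity of D this also covers u = v.
    notInside : ∀ u v → block u ≡ block v → ¬ D ∣ toℕ u - toℕ v ∣
    notInside u v same with u ≟ v
    ... | yes refl = λ d → ℕ.n≮0 (subst (1 ≤_) (ℕ.∣n-n∣≡0 (toℕ u)) (positive d))
    ... | no u≢v = inside u v same u≢v
    -- a ≠ a′ in the G(D) sense: at the witnessing point i, equal images would put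
    -- a i and a′ i into one block, at a distance in D.
    differentFirst : ∀ a a′ F G → GDifferent D a a′ → Apart (then a F) (then a′ G)
    differentFirst a a′ F G (i , d) = i , λ eq → notInside _ _
      (trans (sym (block-blockwise F (a ⟨$⟩ʳ i))) (trans (cong block eq) (block-blockwise G (a′ ⟨$⟩ʳ i)))) d
    -- Same a, different choices: compare at the preimage under a of a separating point.
    differentSecond : ∀ a F G → (∃ λ b → Apart (F b) (G b)) → Apart (then a F) (then a G)
    differentSecond a F G apart with x , Fx≢Gx ← blockwise-apart F G apart =
      a ⟨$⟩ˡ x , λ eq → Fx≢Gx (subst (λ y → blockwise F ⟨$⟩ʳ y ≡ blockwise G ⟨$⟩ʳ y) (inverseʳ a) eq)
    products-apart : AllPairs Apart products
    products-apart = AllPairs-cartesianProductWith then differentFirst differentSecond family choices-apart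

-- ψ with its coordinates swapped: blocks are the points sharing a low coordinate.
ψᵗ : ∀ j → Fin (4 ^ j) ↔ (Fin (2 ^ j) × Fin (2 ^ j))
ψᵗ j = ↔-trans (ψ j) (×-comm _ _)

-- Blocks of equal high coordinate have within-block distances in E, blocks of
-- equal low coordinate have them in Ebar; E and Ebar are disjoint sets of
-- positive numbers.
theorem2 : (j : ℕ) →
    (T≥ (4 ^ j) E (((2 ^ j) !) ^ (2 ^ j))
    × T*≤ (4 ^ j) E (((2 ^ j) !) ^ (2 ^ j)) ((4 ^ j) !))
    × (T≥ (4 ^ j) Ebar (((2 ^ j) !) ^ (2 ^ j))
    × T*≤ (4 ^ j) Ebar (((2 ^ j) !) ^ (2 ^ j)) ((4 ^ j) !))
theorem2 j =
  ( lowerBound (ψ j) E (sameHighPoints⇒E j)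
  , upperBound (ψᵗ j) E proj₁ (λ u v same u≢v → proj₂ (sameLowPoints⇒Ebar j u v same u≢v)) ) ,
  ( lowerBound (ψᵗ j) Ebar (sameLowPoints⇒Ebar j)
  , upperBound (ψ j) Ebar proj₁ (λ u v same u≢v d → proj₂ d (sameHighPoints⇒E j u v same u≢v)) )
  where open Blocks
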